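{- Let $F:2^{[n]}\to\mathbb{R}$ be $M^\natural$-concave. Then $F$ is strictly submodular if and only if every cell of the regular subdivision of $[0,1]^n$ induced by $F$ via upper hull is contained in $\{x\in[0,1]^n: k\le\sum_{i=1}^n x_i\le k+1\}$ for some $k\in\{0,\dots,n-1\}$.
   Context: $F$ is $M^\natural$-concave if for all $S,T\subseteq[n]$ and all $i\in S\setminus T$, either $F(S)+F(T)\le F(S\setminus\{i\})+F(T\cup\{i\})$, or there is $j\in T\setminus S$ with $F(S)+F(T)\le F((S\cup\{j\})\setminus\{i\})+F((T\cup\{i\})\setminus\{j\})$. $F$ is strictly submodular if $F(S)+F(S\cup\{i,j\})<F(S\cup\{i\})+F(S\cup\{j\})$ for all $S\subseteq[n]$ and distinct $i,j\in[n]\setminus S$. The regular subdivision induced via upper hull: lift each vertex $e_S=\sum_{i\in S}e_i$ of the cube to $(e_S,F(S))$, take the upper faces of the convex hull of the lifted points, and project them to $\mathbb{R}^n$. -}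

module Defs where

open import Level using (0ℓ)
open import Data.Nat using (ℕ; zero; suc)
open import Data.Bool using (Bool; true; false)
open import Data.Fin using (Fin; toℕ)
open import Data.Fin.Subset using (Subset; inside; outside; _∈_; _∉_; _∪_; ⁅_⁆) renaming (_-_ to _∖_)
open import Data.Vec using ([]; _∷_; lookup)
open import Data.Product using (Σ; ∃; _×_)
open import Data.Sum using (_⊎_)
open import Relation.Nullary using (¬_)
open import Relation.Binary.PropositionalEquality using (_≢_)
open import Relation.Binary.Structures using (IsTotalOrder)
open import Algebra.Bundles using (CommutativeRing)

-- An ordered field (every axiom holds in ℝ).  The theorem is stated for an
-- arbitrary ordered field; ℝ is an instance.
record OrderedField : Set₁ where
  field
    cring : CommutativeRing 0ℓ 0ℓ
  open CommutativeRing cring public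
  field
    _≤_           : Carrier → Carrier → Set
    ≤-isTotalOrder : IsTotalOrder _≈_ _≤_
    +-monoʳ-≤     : ∀ {x y} z → x ≤ y → (x + z) ≤ (y + z)
    *-nonneg      : ∀ {x y} → 0# ≤ x → 0# ≤ y → 0# ≤ (x * y)
    0≉1           : ¬ (0# ≈ 1#)
    inv           : (x : Carrier) → ¬ (x ≈ 0#) → Carrier
    inv-inverse   : ∀ x (p : ¬ (x ≈ 0#)) → (x * inv x p) ≈ 1#

module _ (K : OrderedField) where
  open OrderedField K

  _<_ : Carrier → Carrier → Set
  x < y = (x ≤ y) × ¬ (x ≈ y)

  fromℕ : ℕ → Carrier
  fromℕ zero    = 0#
  fromℕ (suc k) = 1# + fromℕ k

  sumFin : (n : ℕ) → (Fin n → Carrier) → Carrier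
  sumFin zero    f = 0#
  sumFin (suc n) f = f Fin.zero + sumFin n (λ i → f (Fin.suc i))

  sumSub : (n : ℕ) → (Subset n → Carrier) → Carrier
  sumSub zero    f = f []
  sumSub (suc n) f = sumSub n (λ S → f (inside ∷ S)) + sumSub n (λ S → f (outside ∷ S))

  -- the i-th coordinate of the cube vertex e_S = Σ_{i∈S} e_i
  eVec : ∀ {n} → Subset n → Fin n → Carrier
  eVec S i with lookup S i
  ... | true  = 1#
  ... | false = 0#

  MNatConcave : ∀ {n} → (Subset n → Carrier) → Set
  MNatConcave {n} F =
    ∀ (S T : Subset n) (i : Fin n) → i ∈ S → i ∉ T →
      ((F S + F T) ≤ (F (S ∖ i) + F (T ∪ ⁅ i ⁆)))
      ⊎ (Σ (Fin n) λ j → j ∈ T × j ∉ S ×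
           ((F S + F T) ≤ (F ((S ∪ ⁅ j ⁆) ∖ i) + F ((T ∪ ⁅ i ⁆) ∖ j))))

  StrictlySubmodular : ∀ {n} → (Subset n → Carrier) → Set
  StrictlySubmodular {n} F =
    ∀ (S : Subset n) (i j : Fin n) → i ≢ j → i ∉ S → j ∉ S →
      (F S + F ((S ∪ ⁅ i ⁆) ∪ ⁅ j ⁆)) < (F (S ∪ ⁅ i ⁆) + F (S ∪ ⁅ j ⁆))

  pair : ∀ {n} → (Fin n → Carrier) → Subset n → Carrier
  pair {n} w S = sumFin n (λ i → w i * eVec S i)

  -- The lifted point (e_S, F(S)) lies on the upper face of conv{(e_T,F(T))}
  -- with outer normal (-w, 1): it maximises F(T) - ⟨w, e_T⟩.
  -- Every upper face (outer normal with positive last coordinate, rescaled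
  -- to 1) is of this form for a unique w ∈ K^n.
  OnUpperFace : ∀ {n} → (Subset n → Carrier) → (Fin n → Carrier) → Subset n → Set
  OnUpperFace F w S = ∀ T → (F T - pair w T) ≤ (F S - pair w S)

  -- x ∈ K^n lies in the cell (projection of the upper face with normal (-w,1)):
  -- x is a convex combination of the vertices e_S whose lifts lie on that face.
  InCell : ∀ {n} → (Subset n → Carrier) → (Fin n → Carrier) → (Fin n → Carrier) → Set
  InCell {n} F w x =
    Σ (Subset n → Carrier) λ c →
        (∀ S → 0# ≤ c S)
      × (sumSub n c ≈ 1#)
      × (∀ S → ¬ OnUpperFace F w S → c S ≈ 0#)
      × (∀ i → x i ≈ sumSub n (λ S → c S * eVec S i))

  CellsInSlabs : ∀ {n} → (Subset n → Carrier) → Set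
  CellsInSlabs {n} F =
    ∀ (w : Fin n → Carrier) →
      Σ (Fin n) λ k → ∀ (x : Fin n → Carrier) → InCell F w x →
        (fromℕ (toℕ k) ≤ sumFin n x) × (sumFin n x ≤ fromℕ (suc (toℕ k)))

module Submission where

-- For w ∈ Kⁿ the cell with upper normal (-w, 1) is the convex hull of the e_S with S maximising
-- the tilt F - ⟨w, ·⟩, so the cells lie in slabs iff, for every w, the sizes of these maximisers
-- lie in some {k, k + 1}.  Tilting preserves M♮-concavity and strict submodularity.  Maximisers
-- of an M♮-concave function can be augmented: if S and T are maximisers with |S| < |T|, then so
-- is some S ∪ {i} (iterate the exchange axiom).  Augmenting twice from a maximiser A towards a
-- maximiser B with |B| ≥ |A| + 2 yields maximisers U and U ∪ {i, j}, which strict submodularity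
-- forbids.  Conversely M♮-concavity already gives submodularity, and if equality
-- F(S) + F(S+i+j) = F(S+i) + F(S+j) holds, F is affine on that square: a tilt levelling the
-- square plus a large penalty on every coordinate outside {i, j} puts the whole square on one
-- upper face, whose cell meets the layers |S| and |S| + 2.

open import Defs

import Algebra.Properties.CommutativeSemigroup as CommutativeSemigroupProperties
import Algebra.Properties.Group as GroupProperties
import Algebra.Properties.Ring as RingProperties
open import Data.Bool as Bool using (Bool)
open import Data.Bool.Properties using (∨-zeroʳ; ∨-identityʳ)
open import Data.Fin as Fin using (Fin; zero; suc; toℕ)
open import Data.Fin.Properties using (any?; toℕ-fromℕ<; toℕ-fromℕ)
open import Data.Fin.Subset
  using (Subset; inside; outside; ⁅_⁆; _∪_; _─_; _∈_; _∉_; _⊂_; ∣_∣) renaming (_-_ to _∖_; ⊥ to ∅)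
open import Data.Fin.Subset.Properties
  using ( ∪-identityʳ; ∪-assoc; ∪-comm; ∣p∣≤n; ∣p∣≤∣x∷p∣; p─⊥≡p; p⊂q⇒∣p∣<∣q∣; drop-there
        ; x∈p∪q⁺; x∈p∪q⁻; x∈⁅x⁆; x∈⁅y⁆⇒x≡y; x∈p∧x∉q⇒x∈p─q; x∈p∧x≢y⇒x∈p-y )
open import Data.Maybe using (nothing)
open import Data.Nat as ℕ using (ℕ; _∸_)
import Data.Nat.Properties as ℕ
open import Data.Product using (Σ; ∃; _×_; _,_; proj₁; proj₂; uncurry)
open import Data.Sum as Sum using (_⊎_; inj₁; inj₂)
open import Data.Unit using (⊤; tt)
open import Data.Vec using (Vec; []; _∷_; lookup; replicate; tabulate; _[_]≔_; here; there)
open import Data.Vec.Properties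
  using ( []≔-lookup; []≔-idempotent; []=⇒lookup; lookup⇒[]=
        ; lookup∘update; lookup∘update′; lookup∘tabulate; tabulate∘lookup; tabulate-cong )
open import Function using (_∘_)
open import Function.Bundles using (_⇔_; mk⇔)
open import Function.Properties.Equivalence using () renaming (trans to ⇔-trans; sym to ⇔-sym)
open import Relation.Binary.Bundles using (Poset)
open import Relation.Binary.Definitions using (tri<; tri≈; tri>)
open import Relation.Binary.PropositionalEquality as ≡ using (_≡_; _≢_; cong; cong₂; subst)
import Relation.Binary.Reasoning.PartialOrder as PosetReasoning
import Relation.Binary.Reasoning.Setoid as SetoidReasoning
open import Relation.Binary.Structures using (IsTotalOrder)
open import Relation.Nullary using (¬_; ¬?; contradiction; yes; no)
open import Relation.Nullary.Decidable using (decidable-stable; _×-dec_)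
open import Relation.Unary using (Decidable)
open import Tactic.RingSolver.Core.AlmostCommutativeRing using (AlmostCommutativeRing; fromCommutativeRing)
import Tactic.RingSolver.NonReflective as NonReflectiveSolver

p∪⁅x⁆≡p[x]≔inside : ∀ {n} (p : Subset n) x → p ∪ ⁅ x ⁆ ≡ p [ x ]≔ inside
p∪⁅x⁆≡p[x]≔inside (s ∷ p) zero    = cong₂ _∷_ (∨-zeroʳ s) (∪-identityʳ p)
p∪⁅x⁆≡p[x]≔inside (s ∷ p) (suc x) = cong₂ _∷_ (∨-identityʳ s) (p∪⁅x⁆≡p[x]≔inside p x)

p-x≡p[x]≔outside : ∀ {n} (p : Subset n) x → p ∖ x ≡ p [ x ]≔ outside
p-x≡p[x]≔outside (s ∷ p) zero    = cong (outside ∷_) (p─⊥≡p p)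
p-x≡p[x]≔outside (s ∷ p) (suc x) = cong (s ∷_) (p-x≡p[x]≔outside p x)

lookup-∉ : ∀ {n} {p : Subset n} {x} → x ∉ p → lookup p x ≡ outside
lookup-∉ {p = p} {x} x∉p with lookup p x in eq
... | inside  = contradiction (lookup⇒[]= x p eq) x∉p
... | outside = ≡.refl

x∉p⇒p[x]≔outside≡p : ∀ {n} {p : Subset n} {x} → x ∉ p → p [ x ]≔ outside ≡ p
x∉p⇒p[x]≔outside≡p {p = p} {x} x∉p = subst (λ b → p [ x ]≔ b ≡ p) (lookup-∉ x∉p) ([]≔-lookup p x)

x∈p⇒p[x]≔inside≡p : ∀ {n} {p : Subset n} {x} → x ∈ p → p [ x ]≔ inside ≡ p
x∈p⇒p[x]≔inside≡p {p = p} {x} x∈p = subst (λ b → p [ x ]≔ b ≡ p) ([]=⇒lookup x∈p) ([]≔-lookup p x)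

[p∪⁅x⁆]-x≡p : ∀ {n} {p : Subset n} {x} → x ∉ p → (p ∪ ⁅ x ⁆) ∖ x ≡ p
[p∪⁅x⁆]-x≡p {p = p} {x} x∉p = begin
  (p ∪ ⁅ x ⁆) ∖ x                     ≡⟨ p-x≡p[x]≔outside (p ∪ ⁅ x ⁆) x ⟩
  (p ∪ ⁅ x ⁆) [ x ]≔ outside          ≡⟨ cong (_[ x ]≔ outside) (p∪⁅x⁆≡p[x]≔inside p x) ⟩
  (p [ x ]≔ inside) [ x ]≔ outside    ≡⟨ []≔-idempotent p x ⟩
  p [ x ]≔ outside                    ≡⟨ x∉p⇒p[x]≔outside≡p x∉p ⟩
  p                                   ∎
  where open ≡.≡-Reasoning

p∪⁅x⁆∪⁅y⁆≡p∪⁅y⁆∪⁅x⁆ : ∀ {n} (p : Subset n) x y → (p ∪ ⁅ x ⁆) ∪ ⁅ y ⁆ ≡ (p ∪ ⁅ y ⁆) ∪ ⁅ x ⁆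
p∪⁅x⁆∪⁅y⁆≡p∪⁅y⁆∪⁅x⁆ p x y = begin
  (p ∪ ⁅ x ⁆) ∪ ⁅ y ⁆   ≡⟨ ∪-assoc p ⁅ x ⁆ ⁅ y ⁆ ⟩
  p ∪ (⁅ x ⁆ ∪ ⁅ y ⁆)   ≡⟨ cong (p ∪_) (∪-comm ⁅ x ⁆ ⁅ y ⁆) ⟩
  p ∪ (⁅ y ⁆ ∪ ⁅ x ⁆)   ≡⟨ ∪-assoc p ⁅ y ⁆ ⁅ x ⁆ ⟨
  (p ∪ ⁅ y ⁆) ∪ ⁅ x ⁆   ∎
  where open ≡.≡-Reasoning

x∈p∪⁅x⁆ : ∀ {n} (p : Subset n) x → x ∈ p ∪ ⁅ x ⁆
x∈p∪⁅x⁆ p x = x∈p∪q⁺ (inj₂ (x∈⁅x⁆ x))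

x∉p∪⁅y⁆ : ∀ {n} {p : Subset n} {x y} → x ∉ p → x ≢ y → x ∉ p ∪ ⁅ y ⁆
x∉p∪⁅y⁆ {p = p} {y = y} x∉p x≢y x∈p∪⁅y⁆ with x∈p∪q⁻ p ⁅ y ⁆ x∈p∪⁅y⁆
... | inj₁ x∈p    = x∉p x∈p
... | inj₂ x∈⁅y⁆ = x≢y (x∈⁅y⁆⇒x≡y y x∈⁅y⁆)

x∈p∧y∉p⇒x≢y : ∀ {n} {p : Subset n} {x y} → x ∈ p → y ∉ p → x ≢ y
x∈p∧y∉p⇒x≢y x∈p y∉p ≡.refl = y∉p x∈p

x∈p─q⁻ : ∀ {n} (p q : Subset n) {x} → x ∈ p ─ q → x ∈ p × x ∉ q
x∈p─q⁻ (inside ∷ p)  (outside ∷ q) here        = here , λ ()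
x∈p─q⁻ (outside ∷ p) (outside ∷ q) {zero} ()
x∈p─q⁻ (s ∷ p)       (inside ∷ q)  {zero} ()
x∈p─q⁻ (s ∷ p)       (t ∷ q)       (there x∈p─q) with x∈p─q⁻ p q x∈p─q
... | x∈p , x∉q = there x∈p , x∉q ∘ drop-there

∣p[x]≔inside∣≡1+∣p[x]≔outside∣ : ∀ {n} (p : Subset n) x → ∣ p [ x ]≔ inside ∣ ≡ ℕ.suc ∣ p [ x ]≔ outside ∣
∣p[x]≔inside∣≡1+∣p[x]≔outside∣ (s ∷ p) zero          = ≡.refl
∣p[x]≔inside∣≡1+∣p[x]≔outside∣ (inside ∷ p) (suc x)  = cong ℕ.suc (∣p[x]≔inside∣≡1+∣p[x]≔outside∣ p x)
∣p[x]≔inside∣≡1+∣p[x]≔outside∣ (outside ∷ p) (suc x) = ∣p[x]≔inside∣≡1+∣p[x]≔outside∣ p x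

∣p∪⁅x⁆∣≡1+∣p∣ : ∀ {n} {p : Subset n} {x} → x ∉ p → ∣ p ∪ ⁅ x ⁆ ∣ ≡ ℕ.suc ∣ p ∣
∣p∪⁅x⁆∣≡1+∣p∣ {p = p} {x} x∉p = begin
  ∣ p ∪ ⁅ x ⁆ ∣              ≡⟨ cong ∣_∣ (p∪⁅x⁆≡p[x]≔inside p x) ⟩
  ∣ p [ x ]≔ inside ∣         ≡⟨ ∣p[x]≔inside∣≡1+∣p[x]≔outside∣ p x ⟩
  ℕ.suc ∣ p [ x ]≔ outside ∣  ≡⟨ cong (ℕ.suc ∘ ∣_∣) (x∉p⇒p[x]≔outside≡p x∉p) ⟩
  ℕ.suc ∣ p ∣                 ∎
  where open ≡.≡-Reasoning

∣p∣≡1+∣p-x∣ : ∀ {n} {p : Subset n} {x} → x ∈ p → ∣ p ∣ ≡ ℕ.suc ∣ p ∖ x ∣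
∣p∣≡1+∣p-x∣ {p = p} {x} x∈p = begin
  ∣ p ∣                       ≡⟨ cong ∣_∣ (x∈p⇒p[x]≔inside≡p x∈p) ⟨
  ∣ p [ x ]≔ inside ∣         ≡⟨ ∣p[x]≔inside∣≡1+∣p[x]≔outside∣ p x ⟩
  ℕ.suc ∣ p [ x ]≔ outside ∣  ≡⟨ cong (ℕ.suc ∘ ∣_∣) (p-x≡p[x]≔outside p x) ⟨
  ℕ.suc ∣ p ∖ x ∣             ∎
  where open ≡.≡-Reasoning

∣[p∪⁅y⁆]-x∣≡∣p∣ : ∀ {n} {p : Subset n} {x y} → x ∈ p → y ∉ p → ∣ (p ∪ ⁅ y ⁆) ∖ x ∣ ≡ ∣ p ∣
∣[p∪⁅y⁆]-x∣≡∣p∣ {p = p} {x} {y} x∈p y∉p = ℕ.suc-injective (begin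
  ℕ.suc ∣ (p ∪ ⁅ y ⁆) ∖ x ∣   ≡⟨ ∣p∣≡1+∣p-x∣ (x∈p∪q⁺ (inj₁ x∈p)) ⟨
  ∣ p ∪ ⁅ y ⁆ ∣               ≡⟨ ∣p∪⁅x⁆∣≡1+∣p∣ y∉p ⟩
  ℕ.suc ∣ p ∣                 ∎)
  where open ≡.≡-Reasoning

∣p∣<∣q∣⇒∃x∈q∖p : ∀ {n} (p q : Subset n) → ∣ p ∣ ℕ.< ∣ q ∣ → ∃ λ x → x ∈ q × x ∉ p
∣p∣<∣q∣⇒∃x∈q∖p (s ∷ p)       (outside ∷ q) ∣p∣<∣q∣
  with ∣p∣<∣q∣⇒∃x∈q∖p p q (ℕ.≤-<-trans (∣p∣≤∣x∷p∣ s p) ∣p∣<∣q∣)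
... | x , x∈q , x∉p = suc x , there x∈q , x∉p ∘ drop-there
∣p∣<∣q∣⇒∃x∈q∖p (outside ∷ p) (inside ∷ q)  _ = zero , here , λ ()
∣p∣<∣q∣⇒∃x∈q∖p (inside ∷ p)  (inside ∷ q)  (ℕ.s≤s ∣p∣<∣q∣) with ∣p∣<∣q∣⇒∃x∈q∖p p q ∣p∣<∣q∣
... | x , x∈q , x∉p = suc x , there x∈q , x∉p ∘ drop-there

exchange-shrinks-difference : ∀ {n} {S T : Subset n} {i j} → i ∈ T → i ∉ S → j ∈ S → j ∉ T →
  S ─ ((T ∪ ⁅ j ⁆) ∖ i) ⊂ S ─ T
exchange-shrinks-difference {n} {S} {T} {i} {j} i∈T i∉S j∈S j∉T =
  ⊆-difference , j , x∈p∧x∉q⇒x∈p─q j∈S j∉T , j∉S─T′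
  where
  T′ : Subset n
  T′ = (T ∪ ⁅ j ⁆) ∖ i
  ∈T⇒∈T′ : ∀ {x} → x ∈ T → x ≢ i → x ∈ T′
  ∈T⇒∈T′ x∈T x≢i = x∈p∧x≢y⇒x∈p-y (x∈p∪q⁺ (inj₁ x∈T)) x≢i
  ⊆-difference : ∀ {x} → x ∈ S ─ T′ → x ∈ S ─ T
  ⊆-difference {x} x∈S─T′ with x∈p─q⁻ S T′ x∈S─T′
  ... | x∈S , x∉T′ = x∈p∧x∉q⇒x∈p─q x∈S (λ x∈T → x∉T′ (∈T⇒∈T′ x∈T (x∈p∧y∉p⇒x≢y x∈S i∉S)))
  j∉S─T′ : j ∉ S ─ T′
  j∉S─T′ j∈S─T′ = proj₂ (x∈p─q⁻ S T′ j∈S─T′)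
    (x∈p∧x≢y⇒x∈p-y (x∈p∪⁅x⁆ T j) (x∈p∧y∉p⇒x≢y i∈T j∉T ∘ ≡.sym))

-- For m ≥ n all sizes equal n, which also lies in the last slab {n - 1, n}.
slab-index-fin : ∀ {n} {P : Subset n → Set} → 1 ℕ.≤ n →
  (∃ λ m → ∀ S → P S → m ℕ.≤ ∣ S ∣ × ∣ S ∣ ℕ.≤ ℕ.suc m) →
  Σ (Fin n) λ k → ∀ S → P S → toℕ k ℕ.≤ ∣ S ∣ × ∣ S ∣ ℕ.≤ ℕ.suc (toℕ k)
slab-index-fin {ℕ.suc n} _ (m , in-slab) with m ℕ.<? ℕ.suc n
... | yes m<1+n = Fin.fromℕ< m<1+n , λ S PS →
  ≡.subst (λ t → t ℕ.≤ ∣ S ∣ × ∣ S ∣ ℕ.≤ ℕ.suc t) (≡.sym (toℕ-fromℕ< m<1+n)) (in-slab S PS)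
... | no m≮1+n = Fin.fromℕ n , λ S PS →
  ≡.subst (λ t → t ℕ.≤ ∣ S ∣ × ∣ S ∣ ℕ.≤ ℕ.suc t) (≡.sym (toℕ-fromℕ n))
    (ℕ.≤-trans (ℕ.≤-trans (ℕ.n≤1+n n) (ℕ.≮⇒≥ m≮1+n)) (proj₁ (in-slab S PS)) , ∣p∣≤n S)

lookup-extensionality : ∀ {a} {A : Set a} {n} {xs ys : Vec A n} → (∀ k → lookup xs k ≡ lookup ys k) → xs ≡ ys
lookup-extensionality {xs = xs} {ys} xs≗ys =
  ≡.trans (≡.sym (tabulate∘lookup xs)) (≡.trans (tabulate-cong xs≗ys) (tabulate∘lookup ys))

lookup-p∪⁅x⁆ : ∀ {n} (p : Subset n) {x k} → k ≢ x → lookup (p ∪ ⁅ x ⁆) k ≡ lookup p k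
lookup-p∪⁅x⁆ p {x} {k} k≢x =
  ≡.trans (cong (λ q → lookup q k) (p∪⁅x⁆≡p[x]≔inside p x)) (lookup∘update′ k≢x p inside)

AgreeOutside : ∀ {n} → Fin n → Fin n → Subset n → Subset n → Set
AgreeOutside i j S X = ∀ k → k ≢ i → k ≢ j → lookup X k ≡ lookup S k

agreeOutside⇒≡[]≔ : ∀ {n} {i j : Fin n} {S X} → AgreeOutside i j S X → X ≡ S [ i ]≔ lookup X i [ j ]≔ lookup X j
agreeOutside⇒≡[]≔ {i = i} {j} {S} {X} agree = lookup-extensionality at
  where
  at : ∀ k → lookup X k ≡ lookup (S [ i ]≔ lookup X i [ j ]≔ lookup X j) k
  at k with k Fin.≟ j
  ... | yes ≡.refl = ≡.sym (lookup∘update k (S [ i ]≔ lookup X i) (lookup X k))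
  ... | no k≢j with k Fin.≟ i
  ...   | yes ≡.refl =
    ≡.sym (≡.trans (lookup∘update′ k≢j (S [ k ]≔ lookup X k) (lookup X j)) (lookup∘update k S (lookup X k)))
  ...   | no k≢i     = ≡.trans (agree k k≢i k≢j)
    (≡.sym (≡.trans (lookup∘update′ k≢j (S [ i ]≔ lookup X i) (lookup X j)) (lookup∘update′ k≢i S (lookup X i))))

agreeOutside⊎differ : ∀ {n} (i j : Fin n) S X →
  AgreeOutside i j S X ⊎ ∃ λ k → k ≢ i × k ≢ j × lookup X k ≢ lookup S k
agreeOutside⊎differ i j S X
  with any? (λ k → ¬? (k Fin.≟ i) ×-dec ¬? (k Fin.≟ j) ×-dec ¬? (lookup X k Bool.≟ lookup S k))
... | yes differ = inj₂ differ
... | no ¬differ = inj₁ λ k k≢i k≢j →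
  decidable-stable (lookup X k Bool.≟ lookup S k) (λ X≢S → ¬differ (k , k≢i , k≢j , X≢S))

module OrderedFieldProperties (K : OrderedField) where

  open OrderedField K
  module ≤ = IsTotalOrder ≤-isTotalOrder
  open GroupProperties +-group using (//-rightDividesˡ; //-rightDividesʳ; \\-leftDividesˡ; ε⁻¹≈ε; ⁻¹-involutive)
  open RingProperties ring using (-1*x≈-x; x[y-z]≈xy-xz)

  -- Without a zero test the solver only proves identities that need no cancellation;
  -- cancellations go through the group laws instead.
  almostCommutativeRing : AlmostCommutativeRing _ _
  almostCommutativeRing = fromCommutativeRing cring (λ _ → nothing)

  open NonReflectiveSolver almostCommutativeRing using (solve; _⊜_; _⊕_; ⊝_)

  poset : Poset _ _ _
  poset = record { isPartialOrder = ≤.isPartialOrder }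

  module ≤-Reasoning = PosetReasoning poset

  x+a+y≈x+[y+a] : ∀ x a y → (x + a) + y ≈ x + (y + a)
  x+a+y≈x+[y+a] = solve 3 (λ x a y → ((x ⊕ a) ⊕ y) ⊜ (x ⊕ (y ⊕ a))) refl

  x+y+z≈x+z+y : ∀ x y z → (x + y) + z ≈ (x + z) + y
  x+y+z≈x+z+y = solve 3 (λ x y z → ((x ⊕ y) ⊕ z) ⊜ ((x ⊕ z) ⊕ y)) refl

  x+y+[a+b]≈x+b+[y+a] : ∀ x y a b → (x + y) + (a + b) ≈ (x + b) + (y + a)
  x+y+[a+b]≈x+b+[y+a] = solve 4 (λ x y a b → ((x ⊕ y) ⊕ (a ⊕ b)) ⊜ ((x ⊕ b) ⊕ (y ⊕ a))) refl

  x+[x+a+b]≈x+a+[x+b] : ∀ x a b → x + ((x + a) + b) ≈ (x + a) + (x + b)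
  x+[x+a+b]≈x+a+[x+b] = solve 3 (λ x a b → (x ⊕ ((x ⊕ a) ⊕ b)) ⊜ ((x ⊕ a) ⊕ (x ⊕ b))) refl

  a-p+[b-q]≈a+b-[p+q] : ∀ a b p q → (a - p) + (b - q) ≈ (a + b) - (p + q)
  a-p+[b-q]≈a+b-[p+q] = solve 4 (λ a b p q → ((a ⊕ (⊝ p)) ⊕ (b ⊕ (⊝ q))) ⊜ ((a ⊕ b) ⊕ (⊝ (p ⊕ q)))) refl

  a-[b+c]≈a-b-c : ∀ a b c → a - (b + c) ≈ (a - b) - c
  a-[b+c]≈a-b-c = solve 3 (λ a b c → (a ⊕ (⊝ (b ⊕ c))) ⊜ ((a ⊕ (⊝ b)) ⊕ (⊝ c))) refl

  [a+c]-[b+c]≈a-b : ∀ a b c → (a + c) - (b + c) ≈ a - b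
  [a+c]-[b+c]≈a-b a b c = begin
    (a + c) - (b + c)         ≈⟨ a-p+[b-q]≈a+b-[p+q] a c b c ⟨
    (a - b) + (c - c)         ≈⟨ +-congˡ (-‿inverseʳ c) ⟩
    (a - b) + 0#              ≈⟨ +-identityʳ _ ⟩
    a - b                     ∎
    where open SetoidReasoning setoid

  x≈y+[x-y] : ∀ x y → x ≈ y + (x - y)
  x≈y+[x-y] x y = sym (trans (+-comm y (x - y)) (//-rightDividesˡ y x))

  ≤-resp-≈₂ : ∀ {x x′ y y′} → x ≈ x′ → y ≈ y′ → x ≤ y → x′ ≤ y′
  ≤-resp-≈₂ x≈x′ y≈y′ x≤y = ≤.≤-respʳ-≈ y≈y′ (≤.≤-respˡ-≈ x≈x′ x≤y)

  +-monoˡ-≤ : ∀ {x y} z → x ≤ y → (z + x) ≤ (z + y)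
  +-monoˡ-≤ {x} {y} z x≤y = ≤-resp-≈₂ (+-comm x z) (+-comm y z) (+-monoʳ-≤ z x≤y)

  +-mono-≤ : ∀ {x y u v} → x ≤ y → u ≤ v → (x + u) ≤ (y + v)
  +-mono-≤ {y = y} {u} x≤y u≤v = ≤.trans (+-monoʳ-≤ u x≤y) (+-monoˡ-≤ y u≤v)

  +-cancelʳ-≤ : ∀ {x y} z → (x + z) ≤ (y + z) → x ≤ y
  +-cancelʳ-≤ {x} {y} z p = ≤-resp-≈₂ (//-rightDividesʳ z x) (//-rightDividesʳ z y) (+-monoʳ-≤ (- z) p)

  +-cancelˡ-≤ : ∀ {x y} z → (z + x) ≤ (z + y) → x ≤ y
  +-cancelˡ-≤ {x} {y} z p = +-cancelʳ-≤ z (≤-resp-≈₂ (+-comm z x) (+-comm z y) p)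

  x≤y⇒0≤y-x : ∀ {x y} → x ≤ y → 0# ≤ (y - x)
  x≤y⇒0≤y-x {x} p = ≤.≤-respˡ-≈ (-‿inverseʳ x) (+-monoʳ-≤ (- x) p)

  0≤y-x⇒x≤y : ∀ {x y} → 0# ≤ (y - x) → x ≤ y
  0≤y-x⇒x≤y {x} {y} p = ≤-resp-≈₂ (+-identityˡ x) (//-rightDividesˡ x y) (+-monoʳ-≤ x p)

  -‿antimono-≤ : ∀ {x y} → x ≤ y → (- y) ≤ (- x)
  -‿antimono-≤ {x} {y} p = ≤-resp-≈₂ (\\-leftDividesˡ x (- y)) y-x-y≈-x (+-monoʳ-≤ (- x + - y) p)
    where
    y-x-y≈-x : y + (- x + - y) ≈ - x
    y-x-y≈-x = trans (+-congˡ (+-comm (- x) (- y))) (\\-leftDividesˡ y (- x))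

  *-monoˡ-≤-nonneg : ∀ {x y} c → 0# ≤ c → x ≤ y → (c * x) ≤ (c * y)
  *-monoˡ-≤-nonneg {x} {y} c 0≤c x≤y =
    0≤y-x⇒x≤y (≤.≤-respʳ-≈ (x[y-z]≈xy-xz c y x) (*-nonneg 0≤c (x≤y⇒0≤y-x x≤y)))

  0≤1 : 0# ≤ 1#
  0≤1 with ≤.total 0# 1#
  ... | inj₁ 0≤1 = 0≤1
  ... | inj₂ 1≤0 = ≤.≤-respʳ-≈ [-1][-1]≈1 (*-nonneg 0≤-1 0≤-1)
    where
    0≤-1 : 0# ≤ (- 1#)
    0≤-1 = ≤.≤-respˡ-≈ ε⁻¹≈ε (-‿antimono-≤ 1≤0)
    [-1][-1]≈1 : (- 1#) * (- 1#) ≈ 1#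
    [-1][-1]≈1 = trans (-1*x≈-x (- 1#)) (⁻¹-involutive 1#)

  -1≤0 : (- 1#) ≤ 0#
  -1≤0 = ≤.≤-respʳ-≈ ε⁻¹≈ε (-‿antimono-≤ 0≤1)

  1≰0 : ¬ (1# ≤ 0#)
  1≰0 1≤0 = 0≉1 (≤.antisym 0≤1 1≤0)

  pairwise-difference-≤ : ∀ {a b c d p q r s} → (a + b) ≤ (c + d) → (p + q) ≈ (r + s) →
    ((a - p) + (b - q)) ≤ ((c - r) + (d - s))
  pairwise-difference-≤ {a} {b} {c} {d} {p} {q} {r} {s} ab≤cd pq≈rs = begin
    (a - p) + (b - q)   ≈⟨ a-p+[b-q]≈a+b-[p+q] a b p q ⟩
    (a + b) - (p + q)   ≤⟨ +-monoʳ-≤ (- (p + q)) ab≤cd ⟩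
    (c + d) - (p + q)   ≈⟨ +-congˡ (-‿cong pq≈rs) ⟩
    (c + d) - (r + s)   ≈⟨ a-p+[b-q]≈a+b-[p+q] c d r s ⟨
    (c - r) + (d - s)   ∎
    where open ≤-Reasoning

  pairwise-difference-≈⁻¹ : ∀ {a b c d p q r s} → ((a - p) + (b - q)) ≈ ((c - r) + (d - s)) → (p + q) ≈ (r + s) →
    (a + b) ≈ (c + d)
  pairwise-difference-≈⁻¹ {a} {b} {c} {d} {p} {q} {r} {s} diff≈ pq≈rs = begin
    a + b                         ≈⟨ //-rightDividesˡ (p + q) (a + b) ⟨
    ((a + b) - (p + q)) + (p + q) ≈⟨ +-cong (sym (a-p+[b-q]≈a+b-[p+q] a b p q)) pq≈rs ⟩
    ((a - p) + (b - q)) + (r + s) ≈⟨ +-congʳ diff≈ ⟩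
    ((c - r) + (d - s)) + (r + s) ≈⟨ +-congʳ (a-p+[b-q]≈a+b-[p+q] c d r s) ⟩
    ((c + d) - (r + s)) + (r + s) ≈⟨ //-rightDividesˡ (r + s) (c + d) ⟩
    c + d                         ∎
    where open SetoidReasoning setoid

module _ (K : OrderedField) where

  open OrderedField K hiding (zero)
  open OrderedFieldProperties K
  open CommutativeSemigroupProperties +-commutativeSemigroup using (interchange)
  open GroupProperties +-group using (∙-cancelʳ)

  fromℕ-nonneg : ∀ k → 0# ≤ fromℕ K k
  fromℕ-nonneg ℕ.zero    = ≤.refl
  fromℕ-nonneg (ℕ.suc k) = ≤.≤-respˡ-≈ (+-identityʳ 0#) (+-mono-≤ 0≤1 (fromℕ-nonneg k))

  fromℕ-mono-≤ : ∀ {a b} → a ℕ.≤ b → fromℕ K a ≤ fromℕ K b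
  fromℕ-mono-≤ {b = b} ℕ.z≤n = fromℕ-nonneg b
  fromℕ-mono-≤ (ℕ.s≤s a≤b)  = +-monoˡ-≤ 1# (fromℕ-mono-≤ a≤b)

  fromℕ-cancel-≤ : ∀ {a b} → fromℕ K a ≤ fromℕ K b → a ℕ.≤ b
  fromℕ-cancel-≤ {ℕ.zero}          _ = ℕ.z≤n
  fromℕ-cancel-≤ {ℕ.suc a} {ℕ.zero} p =
    contradiction (≤.trans (≤.≤-respˡ-≈ (+-identityʳ 1#) (+-monoˡ-≤ 1# (fromℕ-nonneg a))) p) 1≰0
  fromℕ-cancel-≤ {ℕ.suc a} {ℕ.suc b} p = ℕ.s≤s (fromℕ-cancel-≤ (+-cancelˡ-≤ 1# p))

  sumFin-cong : ∀ n {f g : Fin n → Carrier} → (∀ i → f i ≈ g i) → sumFin K n f ≈ sumFin K n g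
  sumFin-cong ℕ.zero    f≈g = refl
  sumFin-cong (ℕ.suc n) f≈g = +-cong (f≈g zero) (sumFin-cong n (f≈g ∘ suc))

  sumFin-mono-≤ : ∀ n {f g : Fin n → Carrier} → (∀ i → f i ≤ g i) → sumFin K n f ≤ sumFin K n g
  sumFin-mono-≤ ℕ.zero    f≤g = ≤.refl
  sumFin-mono-≤ (ℕ.suc n) f≤g = +-mono-≤ (f≤g zero) (sumFin-mono-≤ n (f≤g ∘ suc))

  sumFin-+ : ∀ n (f g : Fin n → Carrier) → sumFin K n (λ i → f i + g i) ≈ sumFin K n f + sumFin K n g
  sumFin-+ ℕ.zero    f g = sym (+-identityʳ 0#)
  sumFin-+ (ℕ.suc n) f g = trans (+-congˡ (sumFin-+ n (f ∘ suc) (g ∘ suc))) (interchange _ _ _ _)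

  sumFin-*ˡ : ∀ n c (f : Fin n → Carrier) → sumFin K n (λ i → c * f i) ≈ c * sumFin K n f
  sumFin-*ˡ ℕ.zero    c f = sym (zeroʳ c)
  sumFin-*ˡ (ℕ.suc n) c f = trans (+-congˡ (sumFin-*ˡ n c (f ∘ suc))) (sym (distribˡ c _ _))

  sumFin-mono-+ : ∀ n {f g : Fin n → Carrier} c → (∀ i → f i ≤ g i) →
    ∀ k → (f k + c) ≤ g k → (sumFin K n f + c) ≤ sumFin K n g
  sumFin-mono-+ (ℕ.suc n) {f} c f≤g zero    gap =
    ≤.≤-respˡ-≈ (sym (x+y+z≈x+z+y _ _ c)) (+-mono-≤ gap (sumFin-mono-≤ n (f≤g ∘ suc)))
  sumFin-mono-+ (ℕ.suc n) {f} c f≤g (suc k) gap =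
    ≤.≤-respˡ-≈ (sym (+-assoc _ _ c)) (+-mono-≤ (f≤g zero) (sumFin-mono-+ n c (f≤g ∘ suc) k gap))

  sumSub-cong : ∀ n {f g : Subset n → Carrier} → (∀ S → f S ≈ g S) → sumSub K n f ≈ sumSub K n g
  sumSub-cong ℕ.zero    f≈g = f≈g []
  sumSub-cong (ℕ.suc n) f≈g = +-cong (sumSub-cong n (f≈g ∘ (inside ∷_))) (sumSub-cong n (f≈g ∘ (outside ∷_)))

  sumSub-mono-≤ : ∀ n {f g : Subset n → Carrier} → (∀ S → f S ≤ g S) → sumSub K n f ≤ sumSub K n g
  sumSub-mono-≤ ℕ.zero    f≤g = f≤g []
  sumSub-mono-≤ (ℕ.suc n) f≤g =
    +-mono-≤ (sumSub-mono-≤ n (f≤g ∘ (inside ∷_))) (sumSub-mono-≤ n (f≤g ∘ (outside ∷_)))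

  sumSub-+ : ∀ n (f g : Subset n → Carrier) → sumSub K n (λ S → f S + g S) ≈ sumSub K n f + sumSub K n g
  sumSub-+ ℕ.zero    f g = refl
  sumSub-+ (ℕ.suc n) f g = trans (+-cong (sumSub-+ n _ _) (sumSub-+ n _ _)) (interchange _ _ _ _)

  sumSub-*ʳ : ∀ n c (f : Subset n → Carrier) → sumSub K n (λ S → f S * c) ≈ sumSub K n f * c
  sumSub-*ʳ ℕ.zero    c f = refl
  sumSub-*ʳ (ℕ.suc n) c f = trans (+-cong (sumSub-*ʳ n c _) (sumSub-*ʳ n c _)) (sym (distribʳ c _ _))

  sumSub-0 : ∀ n {f : Subset n → Carrier} → (∀ S → f S ≈ 0#) → sumSub K n f ≈ 0#
  sumSub-0 ℕ.zero    f≈0 = f≈0 []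
  sumSub-0 (ℕ.suc n) f≈0 =
    trans (+-cong (sumSub-0 n (f≈0 ∘ (inside ∷_))) (sumSub-0 n (f≈0 ∘ (outside ∷_)))) (+-identityʳ 0#)

  sumFin-sumSub-comm : ∀ n m (g : Fin n → Subset m → Carrier) →
    sumFin K n (λ i → sumSub K m (g i)) ≈ sumSub K m (λ S → sumFin K n (λ i → g i S))
  sumFin-sumSub-comm ℕ.zero    m g = sym (sumSub-0 m (λ _ → refl))
  sumFin-sumSub-comm (ℕ.suc n) m g = trans (+-congˡ (sumFin-sumSub-comm n m (g ∘ suc))) (sym (sumSub-+ m _ _))

  sumFin-eVec : ∀ {n} (S : Subset n) → sumFin K n (eVec K S) ≈ fromℕ K ∣ S ∣
  sumFin-eVec []            = refl
  sumFin-eVec (inside ∷ S)  = +-congˡ (sumFin-eVec S)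
  sumFin-eVec (outside ∷ S) = trans (+-identityˡ _) (sumFin-eVec S)

  pair-[]≔inside : ∀ {n} (w : Fin n → Carrier) p x →
    pair K w (p [ x ]≔ inside) ≈ pair K w (p [ x ]≔ outside) + w x
  pair-[]≔inside w (s ∷ p) zero = begin
    w zero * 1# + pair K (w ∘ suc) p         ≈⟨ +-cong (*-identityʳ (w zero)) (sym (+-identityˡ _)) ⟩
    w zero + (0# + pair K (w ∘ suc) p)       ≈⟨ +-comm _ _ ⟩
    (0# + pair K (w ∘ suc) p) + w zero       ≈⟨ +-congʳ (+-congʳ (zeroʳ (w zero))) ⟨
    (w zero * 0# + pair K (w ∘ suc) p) + w zero ∎
    where open SetoidReasoning setoid
  pair-[]≔inside w (s ∷ p) (suc x) =
    trans (+-congˡ (pair-[]≔inside (w ∘ suc) p x)) (sym (+-assoc _ _ _))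

  pair-∪⁅⁆ : ∀ {n} (w : Fin n → Carrier) {p x} → x ∉ p → pair K w (p ∪ ⁅ x ⁆) ≈ pair K w p + w x
  pair-∪⁅⁆ w {p} {x} x∉p = begin
    pair K w (p ∪ ⁅ x ⁆)                ≡⟨ cong (pair K w) (p∪⁅x⁆≡p[x]≔inside p x) ⟩
    pair K w (p [ x ]≔ inside)          ≈⟨ pair-[]≔inside w p x ⟩
    pair K w (p [ x ]≔ outside) + w x   ≡⟨ cong (λ q → pair K w q + w x) (x∉p⇒p[x]≔outside≡p x∉p) ⟩
    pair K w p + w x                    ∎
    where open SetoidReasoning setoid

  pair-∖ : ∀ {n} (w : Fin n → Carrier) {p x} → x ∈ p → pair K w p ≈ pair K w (p ∖ x) + w x
  pair-∖ w {p} {x} x∈p = begin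
    pair K w p                          ≡⟨ cong (pair K w) (x∈p⇒p[x]≔inside≡p x∈p) ⟨
    pair K w (p [ x ]≔ inside)          ≈⟨ pair-[]≔inside w p x ⟩
    pair K w (p [ x ]≔ outside) + w x   ≡⟨ cong (λ q → pair K w q + w x) (p-x≡p[x]≔outside p x) ⟨
    pair K w (p ∖ x) + w x              ∎
    where open SetoidReasoning setoid

  pair-exchange : ∀ {n} (w : Fin n → Carrier) {S T : Subset n} {i} → i ∈ S → i ∉ T →
    pair K w S + pair K w T ≈ pair K w (S ∖ i) + pair K w (T ∪ ⁅ i ⁆)
  pair-exchange w {S} {T} {i} i∈S i∉T = begin
    pair K w S + pair K w T                 ≈⟨ +-congʳ (pair-∖ w i∈S) ⟩
    (pair K w (S ∖ i) + w i) + pair K w T   ≈⟨ x+a+y≈x+[y+a] _ _ _ ⟩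
    pair K w (S ∖ i) + (pair K w T + w i)   ≈⟨ +-congˡ (pair-∪⁅⁆ w i∉T) ⟨
    pair K w (S ∖ i) + pair K w (T ∪ ⁅ i ⁆) ∎
    where open SetoidReasoning setoid

  pair-swap : ∀ {n} (w : Fin n → Carrier) {S : Subset n} {i j} → i ∈ S → j ∉ S →
    pair K w ((S ∪ ⁅ j ⁆) ∖ i) + w i ≈ pair K w S + w j
  pair-swap w {S} {i} {j} i∈S j∉S =
    trans (sym (pair-∖ w (x∈p∪q⁺ (inj₁ i∈S)))) (pair-∪⁅⁆ w j∉S)

  pair-double-exchange : ∀ {n} (w : Fin n → Carrier) {S T : Subset n} {i j} → i ∈ S → i ∉ T → j ∈ T → j ∉ S →
    pair K w S + pair K w T ≈ pair K w ((S ∪ ⁅ j ⁆) ∖ i) + pair K w ((T ∪ ⁅ i ⁆) ∖ j)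
  pair-double-exchange {n} w {S} {T} {i} {j} i∈S i∉T j∈T j∉S = ∙-cancelʳ (w i + w j) _ _ (begin
    (pair K w S + pair K w T) + (w i + w j)   ≈⟨ x+y+[a+b]≈x+b+[y+a] _ _ _ _ ⟩
    (pair K w S + w j) + (pair K w T + w i)   ≈⟨ +-cong (pair-swap w i∈S j∉S) (pair-swap w j∈T i∉T) ⟨
    (pair K w A + w i) + (pair K w B + w j)   ≈⟨ interchange _ _ _ _ ⟩
    (pair K w A + pair K w B) + (w i + w j)   ∎)
    where
    open SetoidReasoning setoid
    A B : Subset n
    A = (S ∪ ⁅ j ⁆) ∖ i
    B = (T ∪ ⁅ i ⁆) ∖ j

  pair-square : ∀ {n} (w : Fin n → Carrier) {U : Subset n} {i j} → i ≢ j → i ∉ U → j ∉ U →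
    pair K w U + pair K w ((U ∪ ⁅ i ⁆) ∪ ⁅ j ⁆) ≈ pair K w (U ∪ ⁅ i ⁆) + pair K w (U ∪ ⁅ j ⁆)
  pair-square w {U} {i} {j} i≢j i∉U j∉U = begin
    pair K w U + pair K w ((U ∪ ⁅ i ⁆) ∪ ⁅ j ⁆)   ≈⟨ +-congˡ (pair-∪⁅⁆ w (x∉p∪⁅y⁆ j∉U (i≢j ∘ ≡.sym))) ⟩
    pair K w U + (pair K w (U ∪ ⁅ i ⁆) + w j)     ≈⟨ +-congˡ (+-congʳ (pair-∪⁅⁆ w i∉U)) ⟩
    pair K w U + ((pair K w U + w i) + w j)       ≈⟨ x+[x+a+b]≈x+a+[x+b] _ _ _ ⟩
    (pair K w U + w i) + (pair K w U + w j)       ≈⟨ +-cong (pair-∪⁅⁆ w i∉U) (pair-∪⁅⁆ w j∉U) ⟨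
    pair K w (U ∪ ⁅ i ⁆) + pair K w (U ∪ ⁅ j ⁆)   ∎
    where open SetoidReasoning setoid

  -- Tilts and their maximisers

  tilt : ∀ {n} → (Fin n → Carrier) → (Subset n → Carrier) → Subset n → Carrier
  tilt w F S = F S - pair K w S

  tilt-linear : ∀ {n} (u v : Fin n → Carrier) c (F : Subset n → Carrier) X →
    tilt (λ k → u k + c * v k) F X ≈ tilt u F X - c * pair K v X
  tilt-linear {n} u v c F X = trans (+-congˡ (-‿cong pair-linear)) (a-[b+c]≈a-b-c _ _ _)
    where
    open SetoidReasoning setoid
    pair-linear : pair K (λ k → u k + c * v k) X ≈ pair K u X + c * pair K v X
    pair-linear = begin
      sumFin K n (λ k → (u k + c * v k) * eVec K X k)             ≈⟨ sumFin-cong n (λ k → distribʳ _ _ _) ⟩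
      sumFin K n (λ k → u k * eVec K X k + (c * v k) * eVec K X k) ≈⟨ sumFin-+ n _ _ ⟩
      pair K u X + sumFin K n (λ k → (c * v k) * eVec K X k)      ≈⟨ +-congˡ (sumFin-cong n (λ k → *-assoc _ _ _)) ⟩
      pair K u X + sumFin K n (λ k → c * (v k * eVec K X k))      ≈⟨ +-congˡ (sumFin-*ˡ n c _) ⟩
      pair K u X + c * pair K v X                                 ∎

  tilt-∪⁅⁆ : ∀ {n} (w : Fin n → Carrier) (F : Subset n → Carrier) {X x} → x ∉ X →
    F (X ∪ ⁅ x ⁆) ≈ F X + w x → tilt w F (X ∪ ⁅ x ⁆) ≈ tilt w F X
  tilt-∪⁅⁆ w F {X} {x} x∉X F-step = begin
    F (X ∪ ⁅ x ⁆) - pair K w (X ∪ ⁅ x ⁆)   ≈⟨ +-cong F-step (-‿cong (pair-∪⁅⁆ w x∉X)) ⟩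
    (F X + w x) - (pair K w X + w x)       ≈⟨ [a+c]-[b+c]≈a-b _ _ _ ⟩
    F X - pair K w X                       ∎
    where open SetoidReasoning setoid

  tilt-MNatConcave : ∀ {n} (w : Fin n → Carrier) {F : Subset n → Carrier} →
    MNatConcave K F → MNatConcave K (tilt w F)
  tilt-MNatConcave w F-mnat S T i i∈S i∉T with F-mnat S T i i∈S i∉T
  ... | inj₁ ≤-exchange =
    inj₁ (pairwise-difference-≤ ≤-exchange (pair-exchange w i∈S i∉T))
  ... | inj₂ (j , j∈T , j∉S , ≤-exchange) =
    inj₂ (j , j∈T , j∉S , pairwise-difference-≤ ≤-exchange (pair-double-exchange w i∈S i∉T j∈T j∉S))

  tilt-StrictlySubmodular : ∀ {n} (w : Fin n → Carrier) {F : Subset n → Carrier} →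
    StrictlySubmodular K F → StrictlySubmodular K (tilt w F)
  tilt-StrictlySubmodular w F-strict U i j i≢j i∉U j∉U with F-strict U i j i≢j i∉U j∉U
  ... | ≤-square , ≉-square =
      pairwise-difference-≤ ≤-square (pair-square w i≢j i∉U j∉U)
    , λ ≈-square → ≉-square (pairwise-difference-≈⁻¹ ≈-square (pair-square w i≢j i∉U j∉U))

  -- OnUpperFace K F w S unfolds to IsMaximum (tilt w F) S.
  IsMaximum : ∀ {n} → (Subset n → Carrier) → Subset n → Set
  IsMaximum G S = ∀ T → G T ≤ G S

  argmax-on : ∀ {n} {P : Subset n → Set} → Decidable P → (G : Subset n → Carrier) →
    (∃ λ A → P A × ∀ X → P X → G X ≤ G A) ⊎ (∀ X → ¬ P X)
  argmax-on {ℕ.zero} P? G with P? []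
  ... | yes P[] = inj₁ ([] , P[] , λ { [] _ → ≤.refl })
  ... | no ¬P[] = inj₂ λ { [] → ¬P[] }
  argmax-on {ℕ.suc n} P? G
    with argmax-on (P? ∘ (inside ∷_)) (G ∘ (inside ∷_)) | argmax-on (P? ∘ (outside ∷_)) (G ∘ (outside ∷_))
  ... | inj₂ none₁ | inj₂ none₀ = inj₂ λ { (inside ∷ X) → none₁ X ; (outside ∷ X) → none₀ X }
  ... | inj₁ (A , PA , maxA) | inj₂ none₀ =
    inj₁ (inside ∷ A , PA , λ { (inside ∷ X) PX → maxA X PX ; (outside ∷ X) PX → contradiction PX (none₀ X) })
  ... | inj₂ none₁ | inj₁ (B , PB , maxB) =
    inj₁ (outside ∷ B , PB , λ { (inside ∷ X) PX → contradiction PX (none₁ X) ; (outside ∷ X) PX → maxB X PX })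
  ... | inj₁ (A , PA , maxA) | inj₁ (B , PB , maxB) with ≤.total (G (inside ∷ A)) (G (outside ∷ B))
  ...   | inj₁ GA≤GB =
    inj₁ (outside ∷ B , PB , λ { (inside ∷ X) PX → ≤.trans (maxA X PX) GA≤GB ; (outside ∷ X) PX → maxB X PX })
  ...   | inj₂ GB≤GA =
    inj₁ (inside ∷ A , PA , λ { (inside ∷ X) PX → maxA X PX ; (outside ∷ X) PX → ≤.trans (maxB X PX) GB≤GA })

  maximum-exists : ∀ {n} (G : Subset n → Carrier) → ∃ (IsMaximum G)
  maximum-exists G with argmax-on {P = λ _ → ⊤} (λ _ → yes tt) G
  ... | inj₁ (A , _ , maxA) = A , λ X → maxA X tt
  ... | inj₂ none          = contradiction tt (none ∅)

  argmax-on-maximum : ∀ {n} {G : Subset n → Carrier} {P : Subset n → Set} {A T} →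
    (∀ X → P X → G X ≤ G A) → IsMaximum G T → P T → IsMaximum G A
  argmax-on-maximum maxA-on-P maxT PT X = ≤.trans (maxT X) (maxA-on-P _ PT)

  maximum-transfer : ∀ {n} {G : Subset n → Carrier} {S T A B} → IsMaximum G S → IsMaximum G T →
    (G S + G T) ≤ (G A + G B) → IsMaximum G A × IsMaximum G B
  maximum-transfer {G = G} {S} {T} {A} {B} maxS maxT ≤AB =
      (λ X → ≤.trans (maxS X) (+-cancelʳ-≤ (G T) (≤.trans ≤AB (+-monoˡ-≤ (G A) (maxT B)))))
    , (λ X → ≤.trans (maxT X) (+-cancelˡ-≤ (G S) (≤.trans ≤AB (+-monoʳ-≤ (G B) (maxS A)))))

  maximiser-exchange : ∀ {n} {G : Subset n → Carrier} → MNatConcave K G →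
    ∀ {S T i} → IsMaximum G S → IsMaximum G T → i ∈ S → i ∉ T →
      (IsMaximum G (S ∖ i) × IsMaximum G (T ∪ ⁅ i ⁆))
      ⊎ (∃ λ j → j ∈ T × j ∉ S × IsMaximum G ((S ∪ ⁅ j ⁆) ∖ i) × IsMaximum G ((T ∪ ⁅ i ⁆) ∖ j))
  maximiser-exchange G-mnat {S} {T} {i} maxS maxT i∈S i∉T with G-mnat S T i i∈S i∉T
  ... | inj₁ ≤-exchange                   = inj₁ (maximum-transfer maxS maxT ≤-exchange)
  ... | inj₂ (j , j∈T , j∉S , ≤-exchange) = inj₂ (j , j∈T , j∉S , maximum-transfer maxS maxT ≤-exchange)

  maximiser-augment : ∀ {n} {G : Subset n → Carrier} → MNatConcave K G →
    ∀ {S T} → IsMaximum G S → IsMaximum G T → ∣ S ∣ ℕ.< ∣ T ∣ → ∃ λ i → i ∉ S × IsMaximum G (S ∪ ⁅ i ⁆)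
  maximiser-augment {G = G} G-mnat {S} maxS = go (ℕ.suc _) ℕ.≤-refl
    where
    -- T is exchanged for a maximiser (T ∪ {j}) ∖ {i} of the same size that shares j with S,
    -- so ∣ S ─ T ∣ strictly decreases.
    go : ∀ bound {T} → ∣ S ─ T ∣ ℕ.< bound → IsMaximum G T → ∣ S ∣ ℕ.< ∣ T ∣ →
      ∃ λ i → i ∉ S × IsMaximum G (S ∪ ⁅ i ⁆)
    go (ℕ.suc bound) {T} ∣S─T∣<bound maxT ∣S∣<∣T∣ with ∣p∣<∣q∣⇒∃x∈q∖p S T ∣S∣<∣T∣
    ... | i , i∈T , i∉S with maximiser-exchange G-mnat maxT maxS i∈T i∉S
    ...   | inj₁ (_ , maxS∪i) = i , i∉S , maxS∪i
    ...   | inj₂ (j , j∈S , j∉T , maxT′ , _) =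
      go bound
        (ℕ.<-≤-trans (p⊂q⇒∣p∣<∣q∣ (exchange-shrinks-difference i∈T i∉S j∈S j∉T)) (ℕ.≤-pred ∣S─T∣<bound))
        maxT′
        (≡.subst (∣ S ∣ ℕ.<_) (≡.sym (∣[p∪⁅y⁆]-x∣≡∣p∣ i∈T j∉T)) ∣S∣<∣T∣)

  no-maximiser-square : ∀ {n} {G : Subset n → Carrier} → StrictlySubmodular K G →
    ∀ {U i j} → i ≢ j → i ∉ U → j ∉ U → IsMaximum G U → ¬ IsMaximum G ((U ∪ ⁅ i ⁆) ∪ ⁅ j ⁆)
  no-maximiser-square G-strict {U} {i} {j} i≢j i∉U j∉U maxU maxUij with G-strict U i j i≢j i∉U j∉U
  ... | ≤-square , ≉-square = ≉-square (≤.antisym ≤-square (+-mono-≤ (maxU (U ∪ ⁅ i ⁆)) (maxUij (U ∪ ⁅ j ⁆))))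

  maximiser-sizes-close : ∀ {n} {G : Subset n → Carrier} → MNatConcave K G → StrictlySubmodular K G →
    ∀ {A B} → IsMaximum G A → IsMaximum G B → ∣ B ∣ ℕ.≤ ℕ.suc ∣ A ∣
  maximiser-sizes-close G-mnat G-strict {A} {B} maxA maxB = ℕ.≮⇒≥ too-far
    where
    too-far : ¬ (ℕ.suc ∣ A ∣ ℕ.< ∣ B ∣)
    too-far 1+∣A∣<∣B∣ with maximiser-augment G-mnat maxA maxB (ℕ.<-trans (ℕ.n<1+n _) 1+∣A∣<∣B∣)
    ... | i , i∉A , maxA∪i
      with maximiser-augment G-mnat maxA∪i maxB (≡.subst (ℕ._< ∣ B ∣) (≡.sym (∣p∪⁅x⁆∣≡1+∣p∣ i∉A)) 1+∣A∣<∣B∣)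
    ... | j , j∉A∪i , maxA∪i∪j =
      no-maximiser-square G-strict i≢j i∉A j∉A maxA maxA∪i∪j
      where
      i≢j : i ≢ j
      i≢j = x∈p∧y∉p⇒x≢y (x∈p∪⁅x⁆ A i) j∉A∪i
      j∉A : j ∉ A
      j∉A = j∉A∪i ∘ x∈p∪q⁺ ∘ inj₁

  -- A maximises G off the layer ∣ S₀ ∣.  A maximiser T off that layer makes A a maximiser,
  -- so A is within one of T and S₀: the side of A decides on which side of S₀ the slab lies.
  maximiser-sizes-in-slab : ∀ {n} {G : Subset n → Carrier} →
    (∀ {A B} → IsMaximum G A → IsMaximum G B → ∣ B ∣ ℕ.≤ ℕ.suc ∣ A ∣) →
    ∃ λ m → ∀ S → IsMaximum G S → m ℕ.≤ ∣ S ∣ × ∣ S ∣ ℕ.≤ ℕ.suc m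
  maximiser-sizes-in-slab {G = G} close with maximum-exists G
  ... | S₀ , maxS₀ with argmax-on (λ X → ¬? (∣ X ∣ ℕ.≟ ∣ S₀ ∣)) G
  ...   | inj₂ none-off-layer = ∣ S₀ ∣ , on-layer
    where
    on-layer : ∀ S → IsMaximum G S → ∣ S₀ ∣ ℕ.≤ ∣ S ∣ × ∣ S ∣ ℕ.≤ ℕ.suc ∣ S₀ ∣
    on-layer S _ with decidable-stable (∣ S ∣ ℕ.≟ ∣ S₀ ∣) (none-off-layer S)
    ... | ∣S∣≡∣S₀∣ = ℕ.≤-reflexive (≡.sym ∣S∣≡∣S₀∣) , ℕ.≤-trans (ℕ.≤-reflexive ∣S∣≡∣S₀∣) (ℕ.n≤1+n _)
  ...   | inj₁ (A , ∣A∣≢∣S₀∣ , maxA-off-layer) with ℕ.<-cmp ∣ A ∣ ∣ S₀ ∣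
  ...     | tri≈ _ ∣A∣≡∣S₀∣ _ = contradiction ∣A∣≡∣S₀∣ ∣A∣≢∣S₀∣
  ...     | tri< ∣A∣<∣S₀∣ _ _ = ∣ S₀ ∣ ∸ 1 , λ S maxS →
      ℕ.∸-monoˡ-≤ 1 (close maxS maxS₀) , ℕ.≤-trans (not-above maxS) (ℕ.m≤n+m∸n ∣ S₀ ∣ 1)
    where
    not-above : ∀ {S} → IsMaximum G S → ∣ S ∣ ℕ.≤ ∣ S₀ ∣
    not-above maxS = ℕ.≮⇒≥ λ ∣S₀∣<∣S∣ →
      ℕ.<⇒≱ ∣S₀∣<∣S∣ (ℕ.≤-trans (close (argmax-on-maximum maxA-off-layer maxS (ℕ.>⇒≢ ∣S₀∣<∣S∣)) maxS) ∣A∣<∣S₀∣)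
  ...     | tri> _ _ ∣S₀∣<∣A∣ = ∣ S₀ ∣ , λ S maxS → not-below maxS , close maxS₀ maxS
    where
    not-below : ∀ {S} → IsMaximum G S → ∣ S₀ ∣ ℕ.≤ ∣ S ∣
    not-below maxS = ℕ.≮⇒≥ λ ∣S∣<∣S₀∣ →
      ℕ.<⇒≱ ∣S₀∣<∣A∣ (ℕ.≤-trans (close maxS (argmax-on-maximum maxA-off-layer maxS (ℕ.<⇒≢ ∣S∣<∣S₀∣))) ∣S∣<∣S₀∣)

  -- Cells and the sizes of their vertices

  UpperFacesInSlabs : ∀ {n} → (Subset n → Carrier) → Set
  UpperFacesInSlabs {n} F =
    ∀ (w : Fin n → Carrier) → Σ (Fin n) λ k →
      ∀ S → OnUpperFace K F w S → toℕ k ℕ.≤ ∣ S ∣ × ∣ S ∣ ℕ.≤ ℕ.suc (toℕ k)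

  sumFin-convex-combination : ∀ {n} (c : Subset n → Carrier) {x : Fin n → Carrier} →
    (∀ i → x i ≈ sumSub K n (λ S → c S * eVec K S i)) →
    sumFin K n x ≈ sumSub K n (λ S → c S * fromℕ K ∣ S ∣)
  sumFin-convex-combination {n} c {x} x≈Σce = begin
    sumFin K n x                                           ≈⟨ sumFin-cong n x≈Σce ⟩
    sumFin K n (λ i → sumSub K n (λ S → c S * eVec K S i)) ≈⟨ sumFin-sumSub-comm n n _ ⟩
    sumSub K n (λ S → sumFin K n (λ i → c S * eVec K S i)) ≈⟨ sumSub-cong n (λ S → sumFin-*ˡ n (c S) (eVec K S)) ⟩
    sumSub K n (λ S → c S * sumFin K n (eVec K S))         ≈⟨ sumSub-cong n (λ S → *-congˡ (sumFin-eVec S)) ⟩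
    sumSub K n (λ S → c S * fromℕ K ∣ S ∣)                ∎
    where open SetoidReasoning setoid

  InCell-sum-bounds : ∀ {n} {F : Subset n → Carrier} {w a b} →
    (∀ S → OnUpperFace K F w S → a ℕ.≤ ∣ S ∣ × ∣ S ∣ ℕ.≤ b) →
    ∀ x → InCell K F w x → fromℕ K a ≤ sumFin K n x × sumFin K n x ≤ fromℕ K b
  InCell-sum-bounds {n} {F} {w} {a} {b} on-face⇒between x (c , 0≤c , Σc≈1 , off-face⇒c≈0 , x≈Σce) =
      ≤-resp-≈₂ (weights-sum (fromℕ K a)) (sym sum-x) (sumSub-mono-≤ n lower)
    , ≤-resp-≈₂ (sym sum-x) (weights-sum (fromℕ K b)) (sumSub-mono-≤ n upper)
    where
    sum-x : sumFin K n x ≈ sumSub K n (λ S → c S * fromℕ K ∣ S ∣)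
    sum-x = sumFin-convex-combination c x≈Σce
    weights-sum : ∀ u → sumSub K n (λ S → c S * u) ≈ u
    weights-sum u = trans (sumSub-*ʳ n u c) (trans (*-congʳ Σc≈1) (*-identityˡ u))
    weighted-≤ : ∀ S u v → ¬ (OnUpperFace K F w S) ⊎ u ℕ.≤ v → (c S * fromℕ K u) ≤ (c S * fromℕ K v)
    weighted-≤ S u v (inj₁ off-face) = ≤-resp-≈₂ (sym (c≈0⇒c*_≈0 u)) (sym (c≈0⇒c*_≈0 v)) ≤.refl
      where
      c≈0⇒c*_≈0 : ∀ t → c S * fromℕ K t ≈ 0#
      c≈0⇒c*_≈0 t = trans (*-congʳ (off-face⇒c≈0 S off-face)) (zeroˡ _)
    weighted-≤ S _ _ (inj₂ u≤v) = *-monoˡ-≤-nonneg (c S) (0≤c S) (fromℕ-mono-≤ u≤v)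
    lower : ∀ S → (c S * fromℕ K a) ≤ (c S * fromℕ K ∣ S ∣)
    lower S with a ℕ.≤? ∣ S ∣
    ... | yes a≤∣S∣ = weighted-≤ S a ∣ S ∣ (inj₂ a≤∣S∣)
    ... | no  a≰∣S∣ = weighted-≤ S a ∣ S ∣ (inj₁ (a≰∣S∣ ∘ proj₁ ∘ on-face⇒between S))
    upper : ∀ S → (c S * fromℕ K ∣ S ∣) ≤ (c S * fromℕ K b)
    upper S with ∣ S ∣ ℕ.≤? b
    ... | yes ∣S∣≤b = weighted-≤ S ∣ S ∣ b (inj₂ ∣S∣≤b)
    ... | no  ∣S∣≰b = weighted-≤ S ∣ S ∣ b (inj₁ (∣S∣≰b ∘ proj₂ ∘ on-face⇒between S))

  δ : ∀ {n} → Subset n → Subset n → Carrier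
  δ []            []            = 1#
  δ (inside ∷ T)  (inside ∷ X)  = δ T X
  δ (outside ∷ T) (outside ∷ X) = δ T X
  δ (inside ∷ T)  (outside ∷ X) = 0#
  δ (outside ∷ T) (inside ∷ X)  = 0#

  δ-nonneg : ∀ {n} (T X : Subset n) → 0# ≤ δ T X
  δ-nonneg []            []            = 0≤1
  δ-nonneg (inside ∷ T)  (inside ∷ X)  = δ-nonneg T X
  δ-nonneg (outside ∷ T) (outside ∷ X) = δ-nonneg T X
  δ-nonneg (inside ∷ T)  (outside ∷ X) = ≤.refl
  δ-nonneg (outside ∷ T) (inside ∷ X)  = ≤.refl

  δ-≡⊎≈0 : ∀ {n} (T X : Subset n) → X ≡ T ⊎ δ T X ≈ 0#
  δ-≡⊎≈0 []            []            = inj₁ ≡.refl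
  δ-≡⊎≈0 (inside ∷ T)  (inside ∷ X)  = Sum.map₁ (cong (inside ∷_)) (δ-≡⊎≈0 T X)
  δ-≡⊎≈0 (outside ∷ T) (outside ∷ X) = Sum.map₁ (cong (outside ∷_)) (δ-≡⊎≈0 T X)
  δ-≡⊎≈0 (inside ∷ T)  (outside ∷ X) = inj₂ refl
  δ-≡⊎≈0 (outside ∷ T) (inside ∷ X)  = inj₂ refl

  sumSub-δ : ∀ {n} (T : Subset n) (g : Subset n → Carrier) → sumSub K n (λ X → δ T X * g X) ≈ g T
  sumSub-δ             []            g = *-identityˡ (g [])
  sumSub-δ {ℕ.suc n} (inside ∷ T)  g =
    trans (+-cong (sumSub-δ T (g ∘ (inside ∷_))) (sumSub-0 n (λ X → zeroˡ (g (outside ∷ X))))) (+-identityʳ _)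
  sumSub-δ {ℕ.suc n} (outside ∷ T) g =
    trans (+-cong (sumSub-0 n (λ X → zeroˡ (g (inside ∷ X)))) (sumSub-δ T (g ∘ (outside ∷_)))) (+-identityˡ _)

  vertex-InCell : ∀ {n} {F : Subset n → Carrier} {w T} → OnUpperFace K F w T → InCell K F w (eVec K T)
  vertex-InCell {n} {F} {w} {T} onT =
    δ T , δ-nonneg T , trans (sumSub-cong n (λ X → sym (*-identityʳ (δ T X)))) (sumSub-δ T (λ _ → 1#)) ,
    off-face⇒δ≈0 , λ i → sym (sumSub-δ T (λ X → eVec K X i))
    where
    off-face⇒δ≈0 : ∀ X → ¬ OnUpperFace K F w X → δ T X ≈ 0#
    off-face⇒δ≈0 X offX with δ-≡⊎≈0 T X
    ... | inj₁ ≡.refl = contradiction onT offX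
    ... | inj₂ δ≈0    = δ≈0

  CellsInSlabs⇔UpperFacesInSlabs : ∀ {n} {F : Subset n → Carrier} → CellsInSlabs K F ⇔ UpperFacesInSlabs F
  CellsInSlabs⇔UpperFacesInSlabs {n} {F} = mk⇔ cells⇒faces faces⇒cells
    where
    cells⇒faces : CellsInSlabs K F → UpperFacesInSlabs F
    cells⇒faces cells w with cells w
    ... | k , bounds = k , λ S onS →
        fromℕ-cancel-≤ (≤.≤-respʳ-≈ (sumFin-eVec S) (proj₁ (bounds (eVec K S) (vertex-InCell onS))))
      , fromℕ-cancel-≤ (≤.≤-respˡ-≈ (sumFin-eVec S) (proj₂ (bounds (eVec K S) (vertex-InCell onS))))
    faces⇒cells : UpperFacesInSlabs F → CellsInSlabs K F
    faces⇒cells faces w = proj₁ (faces w) , InCell-sum-bounds (proj₂ (faces w))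

  -- Modular squares lie on upper faces

  constant-on-square : ∀ {n} (ψ : Subset n → Carrier) {S i j} → i ≢ j → i ∉ S → j ∉ S →
    ψ (S ∪ ⁅ i ⁆) ≈ ψ S → ψ (S ∪ ⁅ j ⁆) ≈ ψ S → ψ ((S ∪ ⁅ i ⁆) ∪ ⁅ j ⁆) ≈ ψ S →
    ∀ X → AgreeOutside i j S X → ψ X ≈ ψ S
  constant-on-square ψ {S} {i} {j} i≢j i∉S j∉S ψSi ψSj ψSij X agree =
    trans (reflexive (cong ψ (agreeOutside⇒≡[]≔ agree))) (vertex (lookup X i) (lookup X j))
    where
    vertex : ∀ b c → ψ (S [ i ]≔ b [ j ]≔ c) ≈ ψ S
    vertex outside outside = reflexive (cong ψ
      (≡.trans (cong (_[ j ]≔ outside) (x∉p⇒p[x]≔outside≡p i∉S)) (x∉p⇒p[x]≔outside≡p j∉S)))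
    vertex inside outside = trans (reflexive (cong ψ
      (≡.trans (cong (_[ j ]≔ outside) (≡.sym (p∪⁅x⁆≡p[x]≔inside S i)))
               (x∉p⇒p[x]≔outside≡p (x∉p∪⁅y⁆ j∉S (i≢j ∘ ≡.sym)))))) ψSi
    vertex outside inside = trans (reflexive (cong ψ
      (≡.trans (cong (_[ j ]≔ inside) (x∉p⇒p[x]≔outside≡p i∉S)) (≡.sym (p∪⁅x⁆≡p[x]≔inside S j))))) ψSj
    vertex inside inside = trans (reflexive (cong ψ
      (≡.sym (≡.trans (p∪⁅x⁆≡p[x]≔inside (S ∪ ⁅ i ⁆) j) (cong (_[ j ]≔ inside) (p∪⁅x⁆≡p[x]≔inside S i)))))) ψSij

  modular-square⇒level-tilt : ∀ {n} (F : Subset n → Carrier) {S i j} → i ≢ j → i ∉ S → j ∉ S →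
    (F S + F ((S ∪ ⁅ i ⁆) ∪ ⁅ j ⁆)) ≈ (F (S ∪ ⁅ i ⁆) + F (S ∪ ⁅ j ⁆)) →
    ∃ λ w → ∀ X → AgreeOutside i j S X → tilt w F X ≈ tilt w F S
  modular-square⇒level-tilt {n} F {S} {i} {j} i≢j i∉S j∉S modular =
    w , constant-on-square (tilt w F) i≢j i∉S j∉S
          (tilt-∪⁅⁆ w F i∉S F-step-i)
          (tilt-∪⁅⁆ w F j∉S F-step-j)
          (trans (tilt-∪⁅⁆ w F (x∉p∪⁅y⁆ j∉S (i≢j ∘ ≡.sym)) F-step-ij) (tilt-∪⁅⁆ w F i∉S F-step-i))
    where
    a b : Carrier
    a = F (S ∪ ⁅ i ⁆) - F S
    b = F (S ∪ ⁅ j ⁆) - F S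
    wᵢ : Vec Carrier n
    wᵢ = replicate n 0# [ i ]≔ a
    w : Fin n → Carrier
    w = lookup (wᵢ [ j ]≔ b)
    w-i : w i ≡ a
    w-i = ≡.trans (lookup∘update′ i≢j wᵢ b) (lookup∘update i (replicate n 0#) a)
    w-j : w j ≡ b
    w-j = lookup∘update j wᵢ b
    F-step-i : F (S ∪ ⁅ i ⁆) ≈ F S + w i
    F-step-i = trans (x≈y+[x-y] _ _) (reflexive (cong (F S +_) (≡.sym w-i)))
    F-step-j : F (S ∪ ⁅ j ⁆) ≈ F S + w j
    F-step-j = trans (x≈y+[x-y] _ _) (reflexive (cong (F S +_) (≡.sym w-j)))
    F-step-ij : F ((S ∪ ⁅ i ⁆) ∪ ⁅ j ⁆) ≈ F (S ∪ ⁅ i ⁆) + w j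
    F-step-ij = begin
      F ((S ∪ ⁅ i ⁆) ∪ ⁅ j ⁆)                        ≈⟨ x≈y+[x-y] _ (F S) ⟩
      F S + (F ((S ∪ ⁅ i ⁆) ∪ ⁅ j ⁆) - F S)          ≈⟨ +-assoc _ _ _ ⟨
      (F S + F ((S ∪ ⁅ i ⁆) ∪ ⁅ j ⁆)) - F S          ≈⟨ +-congʳ modular ⟩
      (F (S ∪ ⁅ i ⁆) + F (S ∪ ⁅ j ⁆)) - F S          ≈⟨ +-assoc _ _ _ ⟩
      F (S ∪ ⁅ i ⁆) + b                              ≡⟨ cong (F (S ∪ ⁅ i ⁆) +_) w-j ⟨
      F (S ∪ ⁅ i ⁆) + w j                            ∎
      where open SetoidReasoning setoid

  sign : Bool → Carrier
  sign inside  = - 1#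
  sign outside = 1#

  sign-≤ : ∀ {n} (S X : Subset n) k → (sign (lookup S k) * eVec K S k) ≤ (sign (lookup S k) * eVec K X k)
  sign-≤ S X k with lookup S k | lookup X k
  ... | inside  | inside  = ≤.refl
  ... | outside | outside = ≤.refl
  ... | inside  | outside = ≤-resp-≈₂ (sym (*-identityʳ _)) (sym (zeroʳ _)) -1≤0
  ... | outside | inside  = ≤-resp-≈₂ (sym (zeroʳ _)) (sym (*-identityʳ _)) 0≤1

  sign-gap : ∀ {n} (S X : Subset n) k → lookup X k ≢ lookup S k →
    ((sign (lookup S k) * eVec K S k) + 1#) ≤ (sign (lookup S k) * eVec K X k)
  sign-gap S X k X≢S with lookup S k | lookup X k
  ... | inside  | inside  = contradiction ≡.refl X≢S
  ... | outside | outside = contradiction ≡.refl X≢S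
  ... | inside  | outside = ≤.reflexive (trans (+-congʳ (*-identityʳ _)) (trans (-‿inverseˡ 1#) (sym (zeroʳ _))))
  ... | outside | inside  = ≤.reflexive (trans (+-congʳ (zeroʳ _)) (trans (+-identityˡ 1#) (sym (*-identityʳ _))))

  -- ⟨penalty S i j, e_X⟩ - ⟨penalty S i j, e_S⟩ counts the coordinates outside {i, j}
  -- where X differs from S.
  penalty : ∀ {n} → Subset n → Fin n → Fin n → Fin n → Carrier
  penalty S i j = lookup (tabulate (sign ∘ lookup S) [ i ]≔ 0# [ j ]≔ 0#)

  penalty-i : ∀ {n} (S : Subset n) {i j} → i ≢ j → penalty S i j i ≡ 0#
  penalty-i S {i} {j} i≢j = ≡.trans
    (lookup∘update′ i≢j (tabulate (sign ∘ lookup S) [ i ]≔ 0#) 0#)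
    (lookup∘update i (tabulate (sign ∘ lookup S)) 0#)

  penalty-j : ∀ {n} (S : Subset n) i j → penalty S i j j ≡ 0#
  penalty-j S i j = lookup∘update j (tabulate (sign ∘ lookup S) [ i ]≔ 0#) 0#

  penalty-off : ∀ {n} (S : Subset n) {i j k} → k ≢ i → k ≢ j → penalty S i j k ≡ sign (lookup S k)
  penalty-off S {i} {j} {k} k≢i k≢j = begin
    penalty S i j k                                  ≡⟨ lookup∘update′ k≢j (tabulate (sign ∘ lookup S) [ i ]≔ 0#) 0# ⟩
    lookup (tabulate (sign ∘ lookup S) [ i ]≔ 0#) k  ≡⟨ lookup∘update′ k≢i (tabulate (sign ∘ lookup S)) 0# ⟩
    lookup (tabulate (sign ∘ lookup S)) k            ≡⟨ lookup∘tabulate (sign ∘ lookup S) k ⟩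
    sign (lookup S k)                                ∎
    where open ≡.≡-Reasoning

  penalty-coordinate-≤ : ∀ {n} (S : Subset n) i j X k →
    (penalty S i j k * eVec K S k) ≤ (penalty S i j k * eVec K X k)
  penalty-coordinate-≤ S i j X k with k Fin.≟ j
  ... | yes ≡.refl rewrite penalty-j S i k = ≤-resp-≈₂ (sym (zeroˡ _)) (sym (zeroˡ _)) ≤.refl
  ... | no k≢j with k Fin.≟ i
  ...   | yes ≡.refl rewrite penalty-i S k≢j = ≤-resp-≈₂ (sym (zeroˡ _)) (sym (zeroˡ _)) ≤.refl
  ...   | no k≢i     rewrite penalty-off S k≢i k≢j = sign-≤ S X k

  pair-penalty-≤ : ∀ {n} (S : Subset n) i j X → pair K (penalty S i j) S ≤ pair K (penalty S i j) X
  pair-penalty-≤ {n} S i j X = sumFin-mono-≤ n (penalty-coordinate-≤ S i j X)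

  pair-penalty-gap : ∀ {n} (S : Subset n) i j X k → k ≢ i → k ≢ j → lookup X k ≢ lookup S k →
    (pair K (penalty S i j) S + 1#) ≤ pair K (penalty S i j) X
  pair-penalty-gap {n} S i j X k k≢i k≢j X≢S = sumFin-mono-+ n 1# (penalty-coordinate-≤ S i j X) k gap
    where
    gap : ((penalty S i j k * eVec K S k) + 1#) ≤ (penalty S i j k * eVec K X k)
    gap rewrite penalty-off S k≢i k≢j = sign-gap S X k X≢S

  pair-penalty-square : ∀ {n} (S : Subset n) {i j} → i ≢ j → i ∉ S → j ∉ S →
    pair K (penalty S i j) ((S ∪ ⁅ i ⁆) ∪ ⁅ j ⁆) ≈ pair K (penalty S i j) S
  pair-penalty-square {n} S {i} {j} i≢j i∉S j∉S = begin
    pair K h ((S ∪ ⁅ i ⁆) ∪ ⁅ j ⁆)  ≈⟨ pair-∪⁅⁆ h (x∉p∪⁅y⁆ j∉S (i≢j ∘ ≡.sym)) ⟩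
    pair K h (S ∪ ⁅ i ⁆) + h j      ≈⟨ +-cong (pair-∪⁅⁆ h i∉S) (reflexive (penalty-j S i j)) ⟩
    (pair K h S + h i) + 0#         ≈⟨ +-identityʳ _ ⟩
    pair K h S + h i                ≈⟨ +-congˡ (reflexive (penalty-i S i≢j)) ⟩
    pair K h S + 0#                 ≈⟨ +-identityʳ _ ⟩
    pair K h S                      ∎
    where
    open SetoidReasoning setoid
    h : Fin n → Carrier
    h = penalty S i j

  -- w₀ levels F on the square; M bounds the excess of the levelled function over its value
  -- at S, so adding M · penalty pushes every vertex off the square below that level.
  modular-square⇒upper-face : ∀ {n} (F : Subset n → Carrier) {S i j} → i ≢ j → i ∉ S → j ∉ S →
    (F S + F ((S ∪ ⁅ i ⁆) ∪ ⁅ j ⁆)) ≈ (F (S ∪ ⁅ i ⁆) + F (S ∪ ⁅ j ⁆)) →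
    ∃ λ w → OnUpperFace K F w S × OnUpperFace K F w ((S ∪ ⁅ i ⁆) ∪ ⁅ j ⁆)
  modular-square⇒upper-face {n} F {S} {i} {j} i≢j i∉S j∉S modular =
    w , S-max , λ X → ≤.≤-respʳ-≈ (sym Sij-level) (S-max X)
    where
    Sij : Subset n
    Sij = (S ∪ ⁅ i ⁆) ∪ ⁅ j ⁆
    w₀ : Fin n → Carrier
    w₀ = proj₁ (modular-square⇒level-tilt F i≢j i∉S j∉S modular)
    ψ : Subset n → Carrier
    ψ = tilt w₀ F
    level : ∀ X → AgreeOutside i j S X → ψ X ≈ ψ S
    level = proj₂ (modular-square⇒level-tilt F i≢j i∉S j∉S modular)
    A : Subset n
    A = proj₁ (maximum-exists ψ)
    M : Carrier
    M = ψ A - ψ S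
    h : Fin n → Carrier
    h = penalty S i j
    w : Fin n → Carrier
    w k = w₀ k + M * h k
    0≤M : 0# ≤ M
    0≤M = x≤y⇒0≤y-x (proj₂ (maximum-exists ψ) S)
    ψ≤ψS+M : ∀ X → ψ X ≤ (ψ S + M)
    ψ≤ψS+M X = ≤.≤-respʳ-≈ (x≈y+[x-y] (ψ A) (ψ S)) (proj₂ (maximum-exists ψ) X)
    open ≤-Reasoning
    bound : ∀ X → (ψ X - M * pair K h X) ≤ (ψ S - M * pair K h S)
    bound X with agreeOutside⊎differ i j S X
    ... | inj₁ agree =
      +-mono-≤ (≤.reflexive (level X agree)) (-‿antimono-≤ (*-monoˡ-≤-nonneg M 0≤M (pair-penalty-≤ S i j X)))
    ... | inj₂ (k , k≢i , k≢j , X≢S) = begin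
      ψ X - M * pair K h X                ≤⟨ +-mono-≤ (ψ≤ψS+M X) (-‿antimono-≤ (*-monoˡ-≤-nonneg M 0≤M
                                                 (pair-penalty-gap S i j X k k≢i k≢j X≢S))) ⟩
      (ψ S + M) - M * (pair K h S + 1#)   ≈⟨ +-congˡ (-‿cong (trans (distribˡ M _ 1#) (+-congˡ (*-identityʳ M)))) ⟩
      (ψ S + M) - (M * pair K h S + M)    ≈⟨ [a+c]-[b+c]≈a-b _ _ _ ⟩
      ψ S - M * pair K h S                ∎
    S-max : OnUpperFace K F w S
    S-max X = ≤-resp-≈₂ (sym (tilt-linear w₀ h M F X)) (sym (tilt-linear w₀ h M F S)) (bound X)
    Sij-level : tilt w F Sij ≈ tilt w F S
    Sij-level = trans (tilt-linear w₀ h M F Sij)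
      (trans (+-cong (level Sij (λ k k≢i k≢j → ≡.trans (lookup-p∪⁅x⁆ (S ∪ ⁅ i ⁆) k≢j) (lookup-p∪⁅x⁆ S k≢i)))
                     (-‿cong (*-congˡ (pair-penalty-square S i≢j i∉S j∉S))))
             (sym (tilt-linear w₀ h M F S)))

  -- Slabs and strict submodularity

  MNatConcave⇒submodular : ∀ {n} {F : Subset n → Carrier} → MNatConcave K F →
    ∀ {S i j} → i ≢ j → i ∉ S → j ∉ S → (F S + F ((S ∪ ⁅ i ⁆) ∪ ⁅ j ⁆)) ≤ (F (S ∪ ⁅ i ⁆) + F (S ∪ ⁅ j ⁆))
  MNatConcave⇒submodular {F = F} F-mnat {S} {i} {j} i≢j i∉S j∉S
    with F-mnat ((S ∪ ⁅ i ⁆) ∪ ⁅ j ⁆) S i (x∈p∪q⁺ (inj₁ (x∈p∪⁅x⁆ S i))) i∉S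
  ... | inj₁ ≤-exchange =
    ≤-resp-≈₂ (+-comm _ _) (trans (+-congʳ (reflexive (cong F Sij-i≡Sj))) (+-comm _ _)) ≤-exchange
    where
    Sij-i≡Sj : ((S ∪ ⁅ i ⁆) ∪ ⁅ j ⁆) ∖ i ≡ S ∪ ⁅ j ⁆
    Sij-i≡Sj = ≡.trans (cong (_∖ i) (p∪⁅x⁆∪⁅y⁆≡p∪⁅y⁆∪⁅x⁆ S i j)) ([p∪⁅x⁆]-x≡p (x∉p∪⁅y⁆ i∉S i≢j))
  ... | inj₂ (k , k∈S , k∉Sij , _) = contradiction (x∈p∪q⁺ (inj₁ (x∈p∪q⁺ (inj₁ k∈S)))) k∉Sij

  StrictlySubmodular⇒UpperFacesInSlabs : ∀ {n} {F : Subset n → Carrier} → 1 ℕ.≤ n →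
    MNatConcave K F → StrictlySubmodular K F → UpperFacesInSlabs F
  StrictlySubmodular⇒UpperFacesInSlabs 1≤n F-mnat F-strict w =
    slab-index-fin 1≤n (maximiser-sizes-in-slab
      (maximiser-sizes-close (tilt-MNatConcave w F-mnat) (tilt-StrictlySubmodular w F-strict)))

  UpperFacesInSlabs⇒square-off-face : ∀ {n} {F : Subset n → Carrier} → UpperFacesInSlabs F →
    ∀ {S i j} → i ≢ j → i ∉ S → j ∉ S →
    ∀ w → ¬ (OnUpperFace K F w S × OnUpperFace K F w ((S ∪ ⁅ i ⁆) ∪ ⁅ j ⁆))
  UpperFacesInSlabs⇒square-off-face faces {S} {i} {j} i≢j i∉S j∉S w (onS , onSij) with faces w
  ... | k , in-slab = ℕ.n≮n ∣ S ∣ (ℕ.≤-trans (ℕ.≤-pred ∣Sij∣≤1+k) (proj₁ (in-slab S onS)))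
    where
    ∣Sij∣≡2+∣S∣ : ∣ (S ∪ ⁅ i ⁆) ∪ ⁅ j ⁆ ∣ ≡ ℕ.suc (ℕ.suc ∣ S ∣)
    ∣Sij∣≡2+∣S∣ = ≡.trans (∣p∪⁅x⁆∣≡1+∣p∣ (x∉p∪⁅y⁆ j∉S (i≢j ∘ ≡.sym))) (cong ℕ.suc (∣p∪⁅x⁆∣≡1+∣p∣ i∉S))
    ∣Sij∣≤1+k : ℕ.suc (ℕ.suc ∣ S ∣) ℕ.≤ ℕ.suc (toℕ k)
    ∣Sij∣≤1+k = ≡.subst (ℕ._≤ ℕ.suc (toℕ k)) ∣Sij∣≡2+∣S∣ (proj₂ (in-slab _ onSij))

  UpperFacesInSlabs⇒StrictlySubmodular : ∀ {n} {F : Subset n → Carrier} →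
    MNatConcave K F → UpperFacesInSlabs F → StrictlySubmodular K F
  UpperFacesInSlabs⇒StrictlySubmodular {F = F} F-mnat faces S i j i≢j i∉S j∉S =
      MNatConcave⇒submodular F-mnat i≢j i∉S j∉S
    , uncurry (UpperFacesInSlabs⇒square-off-face faces i≢j i∉S j∉S) ∘ modular-square⇒upper-face F i≢j i∉S j∉S

-- The order of ℕ is opened only here: above, it would clash with the order of the field.
open import Data.Nat using (_≤_)

lemma2p4 : (K : OrderedField) (n : ℕ) → 1 ≤ n →
    (F : Subset n → OrderedField.Carrier K) → MNatConcave K F →
    (StrictlySubmodular K F ⇔ CellsInSlabs K F)
lemma2p4 K n 1≤n F F-mnat = ⇔-trans
  (mk⇔ (StrictlySubmodular⇒UpperFacesInSlabs K 1≤n F-mnat) (UpperFacesInSlabs⇒StrictlySubmodular K F-mnat))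
  (⇔-sym (CellsInSlabs⇔UpperFacesInSlabs K))
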